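{- Let $P_n$ be the path on $n\ge 4$ vertices. Then $F_{cd}(P_n) = \gamma_c(P_n) = n-2$.
   Context: Color-change rule: if each vertex is colored black or white, and a black vertex $u$ has exactly one white neighbor $v$, then $v$ is recolored black. A zero forcing set of $G$ is a set $Z\subseteq V(G)$ such that, starting with exactly the vertices of $Z$ black, repeated application of the color-change rule eventually colors every vertex black. A connected dominating set is a set $D$ such that every vertex is in $D$ or has a neighbor in $D$ and $\langle D\rangle$ is connected; $\gamma_c(G)$ is its minimum size. A connected dom-forcing set of $G$ is a set $S\subseteq V(G)$ that is a connected dominating set and a zero forcing set; $F_{cd}(G)$ is the minimum size of such a set. -}

module Defs where

open import Data.Nat using (ℕ; suc; _≤_)
open import Data.Fin using (Fin; toℕ)
open import Data.Fin.Subset using (Subset; _∈_; ∣_∣)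
open import Data.Product using (Σ; _×_; ∃)
open import Data.Sum using (_⊎_)
open import Relation.Binary.PropositionalEquality using (_≡_; _≢_)

Graph : ℕ → Set₁
Graph n = Fin n → Fin n → Set

pathGraph : (n : ℕ) → Graph n
pathGraph n i j = (toℕ j ≡ suc (toℕ i)) ⊎ (toℕ i ≡ suc (toℕ j))

module _ {n : ℕ} (G : Graph n) where

  -- Vertices eventually coloured black starting from black set Z,
  -- by repeated application of the colour-change rule:
  -- a black vertex u all of whose neighbours other than v are black
  -- (so v is its unique white neighbour, if v is still white) forces v.
  data Black (Z : Subset n) : Fin n → Set where
    initial : ∀ {v} → v ∈ Z → Black Z v
    force   : ∀ {u v} → Black Z u → G u v →
              (∀ w → G u w → w ≢ v → Black Z w) → Black Z v

  ZeroForcing : Subset n → Set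
  ZeroForcing Z = ∀ v → Black Z v

  Dominating : Subset n → Set
  Dominating D = ∀ v → v ∈ D ⊎ Σ (Fin n) (λ u → u ∈ D × G u v)

  data ReachIn (D : Subset n) : Fin n → Fin n → Set where
    here : ∀ {u} → u ∈ D → ReachIn D u u
    step : ∀ {u v w} → u ∈ D → G u v → ReachIn D v w → ReachIn D u w

  InducedConnected : Subset n → Set
  InducedConnected D = ∀ u v → u ∈ D → v ∈ D → ReachIn D u v

  ConnectedDominating : Subset n → Set
  ConnectedDominating D = Dominating D × InducedConnected D

  ConnectedDomForcing : Subset n → Set
  ConnectedDomForcing S = ConnectedDominating S × ZeroForcing S

IsMinimum : {n : ℕ} → (Subset n → Set) → ℕ → Set
IsMinimum {n} P k =
  Σ (Subset n) (λ S → P S × ∣ S ∣ ≡ k) × (∀ S → P S → k ≤ ∣ S ∣)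

γc≡ : {n : ℕ} → Graph n → ℕ → Set
γc≡ G k = IsMinimum (ConnectedDominating G) k

Fcd≡ : {n : ℕ} → Graph n → ℕ → Set
Fcd≡ G k = IsMinimum (ConnectedDomForcing G) k

-- Every connected dominating set D of P_{m+2} contains the m interior vertices 1, …, m:
-- D contains a neighbour-or-self a of vertex 0 and b of vertex m+1, and a walk in ⟨D⟩
-- from a to b moves by ±1, so it passes through every vertex between a ≤ 1 and b ≥ m.
-- Conversely the interior is a connected dominating set, and for m ≥ 2 it is zero
-- forcing: vertex 1 forces 0 and vertex m forces m+1, their other neighbours being interior.
module Submission where

open import Defs
open import Data.Nat using (ℕ; zero; suc; _+_; _∸_; _≤_; _<_; z≤n; s≤s; s≤s⁻¹)
open import Data.Nat.Properties
  using (≤-refl; ≤-reflexive; ≤-trans; ≤-antisym; ≤-total; ≤-<-trans; <⇒≤; n≤1+n;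
         m≤n⇒m≤1+n; m≤n⇒m<n∨m≡n; m≤n+m; m∸n+n≡m; +-suc; suc-injective)
open import Data.Fin using (Fin; toℕ; fromℕ; fromℕ<; inject₁) renaming (zero to fz; suc to fs)
open import Data.Fin.Properties using (toℕ-injective; toℕ<n; toℕ-fromℕ; toℕ-fromℕ<; toℕ-inject₁)
open import Data.Fin.Subset using (Subset; _∈_; ∣_∣; inside; outside)
open import Data.Fin.Subset.Properties using (p⊆q⇒∣p∣≤∣q∣)
open import Data.Vec using (_∷_; replicate; _∷ʳ_; here; there)
open import Data.Product using (_×_; _,_; ∃; proj₁; proj₂)
open import Data.Sum using (_⊎_; inj₁; inj₂; swap)
open import Data.Empty using (⊥-elim)
open import Function using (_∘_)
open import Relation.Binary.PropositionalEquality using (_≡_; _≢_; refl; sym; trans; cong; subst)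

module _ {n : ℕ} {G : Graph n} {D : Subset n} where

  ReachIn-snoc : ∀ {u v w} → ReachIn G D u v → G v w → w ∈ D → ReachIn G D u w
  ReachIn-snoc (here v∈) adj w∈ = step v∈ adj (here w∈)
  ReachIn-snoc (step u∈ adj walk) adj′ w∈ = step u∈ adj (ReachIn-snoc walk adj′ w∈)

  ReachIn-reverse : (∀ {u v} → G u v → G v u) → ∀ {u v} → ReachIn G D u v → ReachIn G D v u
  ReachIn-reverse sym-G (here u∈) = here u∈
  ReachIn-reverse sym-G (step u∈ adj walk) = ReachIn-snoc (ReachIn-reverse sym-G walk) (sym-G adj) u∈

module _ {n : ℕ} where

  pathGraph-sym : ∀ {u v : Fin n} → pathGraph n u v → pathGraph n v u
  pathGraph-sym = swap

  pathGraph-≤suc : ∀ {u v : Fin n} → pathGraph n u v → toℕ v ≤ suc (toℕ u)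
  pathGraph-≤suc (inj₁ v≡1+u) = ≤-reflexive v≡1+u
  pathGraph-≤suc (inj₂ u≡1+v) = m≤n⇒m≤1+n (<⇒≤ (≤-reflexive (sym u≡1+v)))

  walk-covers-interval : ∀ {D : Subset n} {a b k} → ReachIn (pathGraph n) D a b →
                         toℕ a ≤ toℕ k → toℕ k ≤ toℕ b → k ∈ D
  walk-covers-interval {D} (here a∈) a≤k k≤b =
    subst (_∈ D) (toℕ-injective (≤-antisym a≤k k≤b)) a∈
  walk-covers-interval {D} (step a∈ adj walk) a≤k k≤b with m≤n⇒m<n∨m≡n a≤k
  ... | inj₂ a≡k = subst (_∈ D) (toℕ-injective a≡k) a∈
  ... | inj₁ a<k = walk-covers-interval walk (≤-trans (pathGraph-≤suc adj) a<k) k≤b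

  dominator-nearby : ∀ {D : Subset n} → Dominating (pathGraph n) D → ∀ v →
                     ∃ λ a → a ∈ D × toℕ a ≤ suc (toℕ v) × toℕ v ≤ suc (toℕ a)
  dominator-nearby dom v with dom v
  ... | inj₁ v∈ = v , v∈ , n≤1+n _ , n≤1+n _
  ... | inj₂ (a , a∈ , adj) = a , a∈ , pathGraph-≤suc (pathGraph-sym adj) , pathGraph-≤suc adj

  ascending-walk : ∀ {D : Subset n} d {u v} → toℕ v ≡ d + toℕ u →
                   (∀ k → toℕ u ≤ toℕ k → toℕ k ≤ toℕ v → k ∈ D) →
                   ReachIn (pathGraph n) D u v
  ascending-walk {D} zero {u} v≡u between =
    subst (ReachIn (pathGraph n) D u) (toℕ-injective (sym v≡u)) (here (between u ≤-refl (≤-reflexive (sym v≡u))))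
  ascending-walk {D} (suc d) {u} {v} v≡d+1+u between =
    step (between u ≤-refl u≤v) (inj₁ (toℕ-fromℕ< 1+u<n)) (ascending-walk d v≡d+w between′)
    where
    u≤v : toℕ u ≤ toℕ v
    u≤v = ≤-trans (m≤n+m (toℕ u) (suc d)) (≤-reflexive (sym v≡d+1+u))
    1+u<n : suc (toℕ u) < n
    1+u<n = ≤-<-trans (≤-trans (s≤s (m≤n+m (toℕ u) d)) (≤-reflexive (sym v≡d+1+u))) (toℕ<n v)
    w : Fin n
    w = fromℕ< 1+u<n
    v≡d+w : toℕ v ≡ d + toℕ w
    v≡d+w = trans v≡d+1+u (trans (sym (+-suc d (toℕ u))) (cong (d +_) (sym (toℕ-fromℕ< 1+u<n))))
    between′ : ∀ k → toℕ w ≤ toℕ k → toℕ k ≤ toℕ v → k ∈ D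
    between′ k w≤k = between k (≤-trans (n≤1+n _) (subst (_≤ toℕ k) (toℕ-fromℕ< 1+u<n) w≤k))

  interval-walk : ∀ {D : Subset n} {u v} → toℕ u ≤ toℕ v →
                  (∀ k → toℕ u ≤ toℕ k → toℕ k ≤ toℕ v → k ∈ D) →
                  ReachIn (pathGraph n) D u v
  interval-walk u≤v = ascending-walk _ (sym (m∸n+n≡m u≤v))

initialSegment : ∀ m → Subset (suc m)
initialSegment m = replicate m inside ∷ʳ outside

∣initialSegment∣ : ∀ m → ∣ initialSegment m ∣ ≡ m
∣initialSegment∣ zero = refl
∣initialSegment∣ (suc m) = cong suc (∣initialSegment∣ m)

toℕ<⇒∈initialSegment : ∀ {m} (j : Fin (suc m)) → toℕ j < m → j ∈ initialSegment m
toℕ<⇒∈initialSegment {suc m} fz _ = here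
toℕ<⇒∈initialSegment {suc m} (fs j) (s≤s j<m) = there (toℕ<⇒∈initialSegment j j<m)

∈initialSegment⇒toℕ< : ∀ {m} (j : Fin (suc m)) → j ∈ initialSegment m → toℕ j < m
∈initialSegment⇒toℕ< {suc m} fz _ = s≤s z≤n
∈initialSegment⇒toℕ< {suc m} (fs j) (there j∈) = s≤s (∈initialSegment⇒toℕ< j j∈)

module _ {m : ℕ} where

  IsInterior : Fin (suc (suc m)) → Set
  IsInterior i = 1 ≤ toℕ i × toℕ i ≤ m

  interior : Subset (suc (suc m))
  interior = outside ∷ initialSegment m

  ∣interior∣ : ∣ interior ∣ ≡ m
  ∣interior∣ = ∣initialSegment∣ m

  interior-complete : ∀ {i} → IsInterior i → i ∈ interior
  interior-complete {fz} (() , _)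
  interior-complete {fs j} (_ , j<m) = there (toℕ<⇒∈initialSegment j j<m)

  interior-sound : ∀ {i} → i ∈ interior → IsInterior i
  interior-sound {fs j} (there j∈) = s≤s z≤n , ∈initialSegment⇒toℕ< j j∈

  first-interior-last : ∀ i → toℕ i ≡ 0 ⊎ IsInterior i ⊎ toℕ i ≡ suc m
  first-interior-last fz = inj₁ refl
  first-interior-last (fs j) with m≤n⇒m<n∨m≡n (s≤s⁻¹ (toℕ<n j))
  ... | inj₁ j<m = inj₂ (inj₁ (s≤s z≤n , j<m))
  ... | inj₂ j≡m = inj₂ (inj₂ (cong suc j≡m))

  penultimate : Fin (suc (suc m))
  penultimate = inject₁ (fromℕ m)

  toℕ-penultimate : toℕ penultimate ≡ m
  toℕ-penultimate = trans (toℕ-inject₁ (fromℕ m)) (toℕ-fromℕ m)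

  interior⊆connectedDominating : ∀ {D} → ConnectedDominating (pathGraph (suc (suc m))) D →
                                 ∀ {k} → IsInterior k → k ∈ D
  interior⊆connectedDominating (dom , conn) (1≤k , k≤m)
    with dominator-nearby dom fz | dominator-nearby dom (fromℕ (suc m))
  ... | a , a∈ , a≤1 , _ | b , b∈ , _ , last≤1+b =
    walk-covers-interval (conn a b a∈ b∈) (≤-trans a≤1 1≤k) (≤-trans k≤m m≤b)
    where
    m≤b : m ≤ toℕ b
    m≤b = s≤s⁻¹ (subst (_≤ suc (toℕ b)) (toℕ-fromℕ (suc m)) last≤1+b)

  connectedDominating-size : ∀ {D} → ConnectedDominating (pathGraph (suc (suc m))) D → m ≤ ∣ D ∣
  connectedDominating-size {D} cd =
    subst (_≤ ∣ D ∣) ∣interior∣ (p⊆q⇒∣p∣≤∣q∣ (interior⊆connectedDominating cd ∘ interior-sound))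

  interior-interval-closed : ∀ {a b} → a ∈ interior → b ∈ interior →
                             ∀ k → toℕ a ≤ toℕ k → toℕ k ≤ toℕ b → k ∈ interior
  interior-interval-closed a∈ b∈ k a≤k k≤b =
    interior-complete (≤-trans (proj₁ (interior-sound a∈)) a≤k , ≤-trans k≤b (proj₂ (interior-sound b∈)))

  interior-connected : InducedConnected (pathGraph (suc (suc m))) interior
  interior-connected u v u∈ v∈ with ≤-total (toℕ u) (toℕ v)
  ... | inj₁ u≤v = interval-walk u≤v (interior-interval-closed u∈ v∈)
  ... | inj₂ v≤u = ReachIn-reverse pathGraph-sym (interval-walk v≤u (interior-interval-closed v∈ u∈))

  vertex1∈interior : 1 ≤ m → fs fz ∈ interior
  vertex1∈interior 1≤m = interior-complete (≤-refl , 1≤m)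

  penultimate∈interior : 1 ≤ m → penultimate ∈ interior
  penultimate∈interior 1≤m =
    interior-complete (subst (1 ≤_) (sym toℕ-penultimate) 1≤m , ≤-reflexive toℕ-penultimate)

  interior-dominating : 1 ≤ m → Dominating (pathGraph (suc (suc m))) interior
  interior-dominating 1≤m v with first-interior-last v
  ... | inj₁ v≡0 = inj₂ (fs fz , vertex1∈interior 1≤m , inj₂ (cong suc (sym v≡0)))
  ... | inj₂ (inj₁ v-int) = inj₁ (interior-complete v-int)
  ... | inj₂ (inj₂ v≡1+m) =
    inj₂ (penultimate , penultimate∈interior 1≤m , inj₁ (trans v≡1+m (cong suc (sym toℕ-penultimate))))

  interior-zeroForcing : 2 ≤ m → ZeroForcing (pathGraph (suc (suc m))) interior
  interior-zeroForcing 2≤m v with first-interior-last v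
  ... | inj₂ (inj₁ v-int) = initial (interior-complete v-int)
  ... | inj₁ v≡0 =
    force (initial (vertex1∈interior (<⇒≤ 2≤m))) (inj₂ (cong suc (sym v≡0))) others
    where
    others : ∀ w → pathGraph _ (fs fz) w → w ≢ v → Black (pathGraph _) interior w
    others w (inj₁ w≡2) _ =
      initial (interior-complete (subst (1 ≤_) (sym w≡2) (s≤s z≤n) , subst (_≤ m) (sym w≡2) 2≤m))
    others w (inj₂ 1≡1+w) w≢v =
      ⊥-elim (w≢v (toℕ-injective (trans (suc-injective (sym 1≡1+w)) (sym v≡0))))
  ... | inj₂ (inj₂ v≡1+m) =
    force (initial (penultimate∈interior (<⇒≤ 2≤m)))
          (inj₁ (trans v≡1+m (cong suc (sym toℕ-penultimate)))) others
    where
    others : ∀ w → pathGraph _ penultimate w → w ≢ v → Black (pathGraph _) interior w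
    others w (inj₁ w≡1+m) w≢v =
      ⊥-elim (w≢v (toℕ-injective (trans w≡1+m (trans (cong suc toℕ-penultimate) (sym v≡1+m)))))
    others w (inj₂ m≡1+w) _ =
      initial (interior-complete (s≤s⁻¹ (subst (2 ≤_) m≡1+w′ 2≤m) , <⇒≤ (≤-reflexive (sym m≡1+w′))))
      where
      m≡1+w′ : m ≡ suc (toℕ w)
      m≡1+w′ = trans (sym toℕ-penultimate) m≡1+w

  interior-connectedDominating : 1 ≤ m → ConnectedDominating (pathGraph (suc (suc m))) interior
  interior-connectedDominating 1≤m = interior-dominating 1≤m , interior-connected

mainTheorem3 : (n : ℕ) → 4 ≤ n →
    Fcd≡ (pathGraph n) (n ∸ 2) × γc≡ (pathGraph n) (n ∸ 2)
mainTheorem3 (suc (suc m)) (s≤s (s≤s 2≤m)) =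
  ((interior , (cd , interior-zeroForcing 2≤m) , ∣interior∣) , λ _ → connectedDominating-size ∘ proj₁) ,
  ((interior , cd , ∣interior∣) , λ _ → connectedDominating-size)
  where
  cd : ConnectedDominating (pathGraph (suc (suc m))) interior
  cd = interior-connectedDominating (<⇒≤ 2≤m)
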